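{- Let $r\ge 3$, $\ell\ge 2$, and let $H$ be an $n$-vertex $r$-graph of girth $2\ell+2$ with $n^{1+1/\ell-o(1)}$ edges. If $\phi$ is a homomorphism from $C^r_{2\ell+1}$ to $H$, then $\phi(V(C^r_{2\ell+1}))$ induces a linear tree in $H$ with at most $\ell$ edges.
   Context: An $r$-graph is an $r$-uniform hypergraph. $C^r_{k}$ is the $r$-uniform linear cycle with edges $e_i=\{v_{(r-1)(i-1)},\dots,v_{(r-1)i}\}$, $1\le i\le k$ (with $v_0=v_{(r-1)k}$). A homomorphism from $F$ to $H$ is a map $\phi:V(F)\to V(H)$ with $\phi(e)\in E(H)$ for every $e\in E(F)$. A Berge cycle of length $k$ consists of $k$ distinct vertices $v_1,\dots,v_k$ and $k$ distinct edges $e_1,\dots,e_k$ with $\{v_i,v_{i+1}\}\subset e_i$ (indices mod $k$); the girth of a hypergraph is the length of its shortest Berge cycle (two distinct edges sharing at least two vertices form a Berge cycle of length 2), so a hypergraph of girth at least 3 is linear (any two edges share at most one vertex). In a linear hypergraph, a path is a sequence $v_1e_1v_2\cdots e_{k-1}v_k$ of distinct vertices with $\{v_i,v_{i+1}\}\subset e_i$; the hypergraph is connected if any two vertices lie on a common path; a linear tree is a connected linear hypergraph containing no Berge cycle. $o(1)$ denotes a function tending to $0$ as $n\to\infty$. -}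

module Defs where

open import Data.Nat using (ℕ; zero; suc; _+_; _*_; _∸_; _≤_; _<_; _≤ᵇ_; _≡ᵇ_)
open import Data.Bool using (Bool; _∧_; _∨_)
open import Data.Fin using (Fin; zero; suc; toℕ; inject₁; _≟_)
open import Data.Fin.Subset using (Subset; _∈_; _⊆_; _∩_; ∣_∣; ⊤)
open import Data.Vec using (tabulate; lookup)
open import Data.List using (List; length; allFin)
open import Data.Bool.ListAction using (any)
import Data.List.Membership.Propositional as LM
open import Data.Product using (Σ; Σ-syntax; _×_; ∃; ∃-syntax)
open import Data.Empty using (⊥)
open import Relation.Nullary using (¬_; ⌊_⌋)
open import Relation.Binary.PropositionalEquality using (_≡_; _≢_)
open import Function.Definitions using (Injective)

record Hypergraph (n : ℕ) : Set₁ where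
  field
    verts  : Subset n
    IsEdge : Subset n → Set
open Hypergraph public

full : ∀ {n} → (Subset n → Set) → Hypergraph n
full E = record { verts = ⊤ ; IsEdge = E }

Uniform : ∀ {n} → ℕ → Hypergraph n → Set
Uniform r G = ∀ e → IsEdge G e → ∣ e ∣ ≡ r

-- cyclic successor on Fin (suc m): i ↦ i+1 mod (suc m)
next : ∀ {m} → Fin (suc m) → Fin (suc m)
next {zero} _ = zero
next {suc m} zero = suc zero
next {suc m} (suc i) with next {m} i
... | zero = zero
... | suc j = suc (suc j)

BergeCycle : ∀ {n} → Hypergraph n → ℕ → Set
BergeCycle G zero = ⊥
BergeCycle {n} G (suc m) =
  Σ[ v ∈ (Fin (suc m) → Fin n) ] Σ[ e ∈ (Fin (suc m) → Subset n) ]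
    Injective _≡_ _≡_ v × Injective _≡_ _≡_ e ×
    (∀ i → IsEdge G (e i) × v i ∈ e i × v (next i) ∈ e i)

Girth : ∀ {n} → Hypergraph n → ℕ → Set
Girth G g = BergeCycle G g × (∀ k → 2 ≤ k → k < g → ¬ BergeCycle G k)

Linear : ∀ {n} → Hypergraph n → Set
Linear G = ∀ e f → IsEdge G e → IsEdge G f → e ≢ f → ∣ e ∩ f ∣ ≤ 1

record Path {n} (G : Hypergraph n) : Set where
  field
    len   : ℕ
    pv    : Fin (suc len) → Fin n
    pe    : Fin len → Subset n
    pv-inj : Injective _≡_ _≡_ pv
    pv-in : ∀ i → pv i ∈ verts G
    pe-edge : ∀ i → IsEdge G (pe i)
    pe-in₁ : ∀ i → pv (inject₁ i) ∈ pe i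
    pe-in₂ : ∀ i → pv (suc i) ∈ pe i

OnPath : ∀ {n} {G : Hypergraph n} → Fin n → Path G → Set
OnPath x P = ∃[ i ] Path.pv P i ≡ x

Connected : ∀ {n} → Hypergraph n → Set
Connected G = ∀ x y → x ∈ verts G → y ∈ verts G →
  Σ[ P ∈ Path G ] OnPath x P × OnPath y P

LinearTree : ∀ {n} → Hypergraph n → Set
LinearTree G = Linear G × Connected G × (∀ k → 2 ≤ k → ¬ BergeCycle G k)

AtMostEdges : ∀ {n} → ℕ → Hypergraph n → Set
AtMostEdges ℓ G = Σ[ es ∈ List (Subset _) ] length es ≤ ℓ × (∀ e → IsEdge G e → e LM.∈ es)

induced : ∀ {n} → Hypergraph n → Subset n → Hypergraph n
induced G S = record { verts = S ; IsEdge = λ e → IsEdge G e × e ⊆ S }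

image : ∀ {m n} → (Fin m → Fin n) → Subset m → Subset n
image {m} φ s = tabulate λ y → any (λ j → lookup s j ∧ ⌊ φ j ≟ y ⌋) (allFin m)

-- The r-uniform linear cycle C^r_k on vertices v_0 … v_{(r-1)k - 1}:
-- edge i (0 ≤ i < k, i.e. e_{i+1} of the paper) is {v_{(r-1)i}, …, v_{(r-1)(i+1)}},
-- where v_{(r-1)k} = v_0.
linCycleEdge : (r k : ℕ) → Fin k → Subset ((r ∸ 1) * k)
linCycleEdge r k i = tabulate λ j →
  (((r ∸ 1) * toℕ i ≤ᵇ toℕ j) ∧ (toℕ j ≤ᵇ (r ∸ 1) * suc (toℕ i)))
  ∨ ((toℕ j ≡ᵇ 0) ∧ (suc (toℕ i) ≡ᵇ k))

Homomorphism : ∀ {n} (r k : ℕ) → (Fin ((r ∸ 1) * k) → Fin n) → Hypergraph n → Set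
Homomorphism r k φ G = ∀ i → IsEdge G (image φ (linCycleEdge r k i))

{-# OPTIONS --safe #-}
-- The images w_a = φ(e_a) of the k = 2ℓ + 1 edges of C^r_k form a closed walk
-- u_0 w_0 u_1 … w_(k-1) u_0 in H, and u_a ≠ u_(a+1) because |w_a| = r forces φ to be
-- injective on e_a. If some w_a occurred only once, the rest of the walk would join u_(a+1)
-- to u_a without it; erasing its loops gives a Berge path which w_a closes into a Berge cycle
-- of length at most k < 2ℓ + 2. So every w_a occurs twice and there are at most ℓ of them.
-- The same shortcut shows that every edge of H inside the image is one of these w_a, which
-- bounds every Berge cycle of the induced hypergraph by ℓ and rules out two edges sharing two
-- vertices; connectivity comes from the closed walk, which meets an edge through every vertex.
module Submission where

open import Defs
open import Data.Nat using (ℕ; zero; suc; _+_; _*_; _∸_; _≤_; _<_; _≤′_; ≤′-refl; ≤′-step; _≤ᵇ_; _≡ᵇ_; z≤n; s≤s; s≤s⁻¹)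
open import Data.Nat.DivMod using (_%_; _/_; m%n<n; m<n⇒m%n≡m; n%n≡0; m≡m%n+[m/n]*n; m<n*o⇒m/o<n; m/n*n≤m)
open import Data.Nat.Properties
open import Data.Fin using (Fin; zero; suc; toℕ; fromℕ; fromℕ<; inject₁; splitAt; join; punchIn; punchOut)
  renaming (_≟_ to _≟ᶠ_)
open import Data.Fin.Properties
  using (any?; injective⇒≤; join-splitAt; punchIn-punchOut; punchInᵢ≢i; toℕ-fromℕ<; toℕ-fromℕ; toℕ-injective; toℕ<n)
open import Data.Fin.Subset using (Subset; _∈_; _⊆_; _∩_; _∪_; ∣_∣; ⊤; ⊥; ⁅_⁆; Nonempty; inside; outside)
open import Data.Fin.Subset.Properties
  using (∈⊤; ∣⊥∣≡0; ∣p∣≤∣x∷p∣; ∪-identityˡ; x∈p∪q⁺; x∈p∩q⁻; x∈⁅x⁆; p⊆q⇒∣p∣≤∣q∣; nonempty?; _∈?_)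
open import Data.Bool using (Bool; T; _∧_; _∨_)
import Data.Bool as Bool
open import Data.Bool.Properties using (T-≡; T-∧; T-∨)
import Data.Vec as Vec
open import Data.Vec using (_∷_)
open import Data.Vec.Properties using ([]=⇒lookup; lookup⇒[]=; lookup∘tabulate; ≡-dec)
open import Data.Vec.Functional using (insertAt)
open import Data.Vec.Functional.Properties using (insertAt-lookup; insertAt-punchIn)
open import Data.Fin.Relation.Unary.Top using (view; ‵fromℕ; ‵inject₁)
open import Data.List using (List; []; _∷_; length; tabulate; deduplicate; lookup; allFin; foldr)
open import Data.List.Properties using (length-tabulate)
open import Data.List.Membership.Propositional using () renaming (_∈_ to _∈ᴸ_; _∉_ to _∉ᴸ_)
import Data.List.Membership.DecPropositional as DecMembership
open import Data.List.Membership.Propositional.Properties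
  using (∈-tabulate⁺; ∈-tabulate⁻; ∈-deduplicate⁺; ∈-deduplicate⁻; ∈-lookup; ∈-allFin)
open import Data.List.Relation.Unary.Any using (here; there; satisfied)
import Data.List.Relation.Unary.Any as Any
open import Data.List.Relation.Unary.Any.Properties using (lookup-index; any⁺; any⁻)
import Data.List.Relation.Unary.All as All
open import Data.List.Relation.Unary.Unique.Propositional using (Unique; _∷_)
open import Data.List.Relation.Unary.Unique.DecPropositional.Properties using (deduplicate-!)
open import Data.Product using (∃-syntax; ∃₂; _×_; _,_; -,_; proj₁; proj₂)
open import Data.Sum using (_⊎_; inj₁; inj₂; [_,_])
open import Data.Empty using (⊥-elim)
open import Function using (_∘_; Equivalence)
open import Function.Definitions using (Injective)
open import Relation.Nullary using (¬_; ¬?; ⌊_⌋; Dec; yes; no; contradiction; _×-dec_)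
open import Relation.Nullary.Decidable using (toWitness; fromWitness; decidable-stable)
open import Relation.Binary.Definitions using (DecidableEquality)
open import Relation.Binary.PropositionalEquality
  using (_≡_; _≢_; refl; sym; trans; cong; subst; module ≡-Reasoning)

m+m≤k⇒1+m≤k : ∀ {k} m → 2 ≤ k → m + m ≤ k → suc m ≤ k
m+m≤k⇒1+m≤k zero    2≤k _     = ≤-trans (s≤s z≤n) 2≤k
m+m≤k⇒1+m≤k (suc m) _   m+m≤k = ≤-trans (s≤s (m≤n+m (suc m) m)) m+m≤k

m+m≤1+n+n⇒m≤n : ∀ m n → m + m ≤ suc (n + n) → m ≤ n
m+m≤1+n+n⇒m≤n zero    n       _  = z≤n
m+m≤1+n+n⇒m≤n (suc m) zero    le rewrite +-suc m m with le
... | s≤s ()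
m+m≤1+n+n⇒m≤n (suc m) (suc n) le rewrite +-suc m m | +-suc n n =
  s≤s (m+m≤1+n+n⇒m≤n m n (s≤s⁻¹ (s≤s⁻¹ le)))

module _ {A : Set} where

  ≤-length : ∀ {m} {xs : List A} (f : Fin m → A) → Injective _≡_ _≡_ f →
             (∀ i → f i ∈ᴸ xs) → m ≤ length xs
  ≤-length {xs = xs} f f-injective f∈xs = injective⇒≤ λ {i} {j} same-index →
    f-injective (trans (lookup-index (f∈xs i))
                       (trans (cong (lookup xs) same-index) (sym (lookup-index (f∈xs j)))))

  Unique⇒lookup-injective : ∀ {xs : List A} → Unique xs → Injective _≡_ _≡_ (lookup xs)
  Unique⇒lookup-injective (_ ∷ _)   {zero}  {zero}  _  = refl
  Unique⇒lookup-injective (x∉ ∷ _)  {zero}  {suc j} eq = ⊥-elim (All.lookup x∉ (∈-lookup j) eq)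
  Unique⇒lookup-injective (x∉ ∷ _)  {suc i} {zero}  eq = ⊥-elim (All.lookup x∉ (∈-lookup i) (sym eq))
  Unique⇒lookup-injective (_ ∷ xs!) {suc i} {suc j} eq = cong suc (Unique⇒lookup-injective xs! eq)

  -- Each element y of the deduplicated image is hit at a position and, by hypothesis, at a
  -- second one; these 2·|image| positions are pairwise distinct.
  repeated⇒halfCover : DecidableEquality A → ∀ {k} (w : Fin k → A) →
                       (∀ i → ∃[ j ] j ≢ i × w j ≡ w i) →
                       ∃[ ys ] (∀ i → w i ∈ᴸ ys) × length ys + length ys ≤ k
  repeated⇒halfCover _≟_ {k} w repeated = ys , ys-cover , injective⇒≤ positions-injective
    where
    ys : List A
    ys = deduplicate _≟_ (tabulate w)

    ys-cover : ∀ i → w i ∈ᴸ ys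
    ys-cover i = ∈-deduplicate⁺ _≟_ (∈-tabulate⁺ i)

    first : Fin (length ys) → Fin k
    first y = proj₁ (∈-tabulate⁻ (∈-deduplicate⁻ _≟_ (tabulate w) (∈-lookup y)))

    second : Fin (length ys) → Fin k
    second y = proj₁ (repeated (first y))

    w-first : ∀ y → w (first y) ≡ lookup ys y
    w-first y = sym (proj₂ (∈-tabulate⁻ (∈-deduplicate⁻ _≟_ (tabulate w) (∈-lookup y))))

    w-second : ∀ y → w (second y) ≡ lookup ys y
    w-second y = trans (proj₂ (proj₂ (repeated (first y)))) (w-first y)

    same-entry : ∀ {y z} → lookup ys y ≡ lookup ys z → y ≡ z
    same-entry = Unique⇒lookup-injective (deduplicate-! _≟_ (tabulate w))

    position : Fin (length ys) ⊎ Fin (length ys) → Fin k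
    position = [ first , second ]

    position-injective : Injective _≡_ _≡_ position
    position-injective {inj₁ y} {inj₁ z} eq =
      cong inj₁ (same-entry (trans (sym (w-first y)) (trans (cong w eq) (w-first z))))
    position-injective {inj₂ y} {inj₂ z} eq =
      cong inj₂ (same-entry (trans (sym (w-second y)) (trans (cong w eq) (w-second z))))
    position-injective {inj₁ y} {inj₂ z} eq
      with refl ← same-entry (trans (sym (w-first y)) (trans (cong w eq) (w-second z)))
      = ⊥-elim (proj₁ (proj₂ (repeated (first y))) (sym eq))
    position-injective {inj₂ y} {inj₁ z} eq
      with refl ← same-entry (trans (sym (w-second y)) (trans (cong w eq) (w-first z)))
      = ⊥-elim (proj₁ (proj₂ (repeated (first y))) eq)

    positions-injective : Injective _≡_ _≡_ (position ∘ splitAt (length ys))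
    positions-injective {i} {j} eq = begin
      i                                      ≡⟨ sym (join-splitAt (length ys) (length ys) i) ⟩
      join _ _ (splitAt (length ys) i)       ≡⟨ cong (join _ _) (position-injective {splitAt _ i} {splitAt _ j} eq) ⟩
      join _ _ (splitAt (length ys) j)       ≡⟨ join-splitAt (length ys) (length ys) j ⟩
      j                                      ∎
      where open ≡-Reasoning

∣⁅x⁆∪p∣≤1+∣p∣ : ∀ {n} x (p : Subset n) → ∣ ⁅ x ⁆ ∪ p ∣ ≤ suc ∣ p ∣
∣⁅x⁆∪p∣≤1+∣p∣ zero    (s ∷ p)       rewrite ∪-identityˡ p = s≤s (∣p∣≤∣x∷p∣ s p)
∣⁅x⁆∪p∣≤1+∣p∣ (suc x) (inside ∷ p)  = s≤s (∣⁅x⁆∪p∣≤1+∣p∣ x p)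
∣⁅x⁆∪p∣≤1+∣p∣ (suc x) (outside ∷ p) = ∣⁅x⁆∪p∣≤1+∣p∣ x p

module _ {n : ℕ} where

  ∣p∣≤length : ∀ {p : Subset n} xs → (∀ {x} → x ∈ p → x ∈ᴸ xs) → ∣ p ∣ ≤ length xs
  ∣p∣≤length {p} xs p⊆xs = ≤-trans (p⊆q⇒∣p∣≤∣q∣ (elements-⊆ xs ∘ p⊆xs)) (∣elements∣≤length xs)
    where
    elements : List (Fin n) → Subset n
    elements = foldr (λ x q → ⁅ x ⁆ ∪ q) ⊥

    elements-⊆ : ∀ ys {x} → x ∈ᴸ ys → x ∈ elements ys
    elements-⊆ (y ∷ ys) (here refl)  = x∈p∪q⁺ (inj₁ (x∈⁅x⁆ y))
    elements-⊆ (y ∷ ys) (there x∈ys) = x∈p∪q⁺ (inj₂ (elements-⊆ ys x∈ys))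

    ∣elements∣≤length : ∀ ys → ∣ elements ys ∣ ≤ length ys
    ∣elements∣≤length []       = ≤-reflexive (∣⊥∣≡0 n)
    ∣elements∣≤length (y ∷ ys) = ≤-trans (∣⁅x⁆∪p∣≤1+∣p∣ y _) (s≤s (∣elements∣≤length ys))

  ∣p∣≥1⇒Nonempty : ∀ {p : Subset n} → 1 ≤ ∣ p ∣ → Nonempty p
  ∣p∣≥1⇒Nonempty {p} ∣p∣≥1 with nonempty? p
  ... | yes nonempty = nonempty
  ... | no empty     = contradiction (∣p∣≤length [] (λ x∈p → ⊥-elim (empty (-, x∈p)))) (<⇒≱ ∣p∣≥1)

  ∣p∣≥2⇒distinct : ∀ {p : Subset n} → 2 ≤ ∣ p ∣ → ∃₂ λ x y → x ≢ y × x ∈ p × y ∈ p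
  ∣p∣≥2⇒distinct {p} ∣p∣≥2 with ∣p∣≥1⇒Nonempty (≤-trans (s≤s z≤n) ∣p∣≥2)
  ... | x , x∈p with any? (λ y → (y ∈? p) ×-dec (¬? (x ≟ᶠ y)))
  ...   | yes (y , y∈p , x≢y) = x , y , x≢y , x∈p , y∈p
  ...   | no ∄y = contradiction (∣p∣≤length (x ∷ []) only-x) (<⇒≱ ∣p∣≥2)
    where
    only-x : ∀ {y} → y ∈ p → y ∈ᴸ x ∷ []
    only-x {y} y∈p with x ≟ᶠ y
    ... | yes refl = here refl
    ... | no x≢y   = ⊥-elim (∄y (y , y∈p , x≢y))

T⇒∈tabulate : ∀ {m} {h : Fin m → Bool} {x} → T (h x) → x ∈ Vec.tabulate h
T⇒∈tabulate {h = h} {x} hx =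
  lookup⇒[]= x (Vec.tabulate h) (trans (lookup∘tabulate h x) (Equivalence.to T-≡ hx))

∈tabulate⇒T : ∀ {m} {h : Fin m → Bool} {x} → x ∈ Vec.tabulate h → T (h x)
∈tabulate⇒T {h = h} {x} x∈ =
  Equivalence.from T-≡ (trans (sym (lookup∘tabulate h x)) ([]=⇒lookup x∈))

∈-image⁺ : ∀ {m n} (φ : Fin m → Fin n) {s : Subset m} {j} → j ∈ s → φ j ∈ image φ s
∈-image⁺ φ {s} {j} j∈s = T⇒∈tabulate (any⁺ _ (Any.map (λ { refl → hit }) (∈-allFin j)))
  where
  hit : T (Vec.lookup s j ∧ ⌊ φ j ≟ᶠ φ j ⌋)
  hit = Equivalence.from T-∧ (Equivalence.from T-≡ ([]=⇒lookup j∈s) , fromWitness refl)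

∈-image⁻ : ∀ {m n} (φ : Fin m → Fin n) (s : Subset m) {y} → y ∈ image φ s → ∃[ j ] j ∈ s × φ j ≡ y
∈-image⁻ {m} φ s y∈ with satisfied (any⁻ _ (allFin m) (∈tabulate⇒T y∈))
... | j , hit with Equivalence.to T-∧ hit
...   | j∈s , φj≡y = j , lookup⇒[]= j s (Equivalence.to T-≡ j∈s) , toWitness φj≡y

_≟ˢ_ : ∀ {n} → DecidableEquality (Subset n)
_≟ˢ_ = ≡-dec Bool._≟_

_∈ᵛ?_ : ∀ {n} (x : Fin n) xs → Dec (x ∈ᴸ xs)
_∈ᵛ?_ = DecMembership._∈?_ _≟ᶠ_

_∈ᵉ?_ : ∀ {n} (g : Subset n) gs → Dec (g ∈ᴸ gs)
_∈ᵉ?_ = DecMembership._∈?_ _≟ˢ_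

next-inject₁ : ∀ {t} (i : Fin t) → next (inject₁ i) ≡ suc i
next-inject₁ {suc t} zero                          = refl
next-inject₁ {suc t} (suc i) rewrite next-inject₁ i = refl

next-fromℕ : ∀ t → next (fromℕ t) ≡ zero
next-fromℕ zero                         = refl
next-fromℕ (suc t) rewrite next-fromℕ t = refl

punchIn-fromℕ : ∀ {t} (i : Fin t) → punchIn (fromℕ t) i ≡ inject₁ i
punchIn-fromℕ zero    = refl
punchIn-fromℕ (suc i) = cong suc (punchIn-fromℕ i)

fresh-head⇒injective : ∀ {A : Set} {t} {f : Fin (suc t) → A} →
                       (∀ i → f zero ≢ f (suc i)) → Injective _≡_ _≡_ (f ∘ suc) → Injective _≡_ _≡_ f
fresh-head⇒injective fresh tail-injective {zero}  {zero}  _  = refl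
fresh-head⇒injective fresh tail-injective {zero}  {suc j} eq = ⊥-elim (fresh j eq)
fresh-head⇒injective fresh tail-injective {suc i} {zero}  eq = ⊥-elim (fresh i (sym eq))
fresh-head⇒injective fresh tail-injective {suc i} {suc j} eq = cong suc (tail-injective eq)

module _ where

  private
    variable
      n m : ℕ
      G H : Hypergraph n
      s p q x y : Fin n
      g : Subset n
      vs : List (Fin n)
      es L : List (Subset n)

  record Hop (G : Hypergraph n) (p : Fin n) (g : Subset n) (q : Fin n) : Set where
    constructor hop
    field
      isEdge : IsEdge G g
      src    : p ∈ g
      dst    : q ∈ g

  data Walk (G : Hypergraph n) (s : Fin n) : Fin n → Set where
    []  : Walk G s s
    _▷_ : Walk G s p → Hop G p g q → Walk G s q

  _++ᵂ_ : Walk G s p → Walk G p q → Walk G s q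
  W ++ᵂ []      = W
  W ++ᵂ (V ▷ h) = (W ++ᵂ V) ▷ h

  restrict : Hypergraph n → List (Subset n) → Hypergraph n
  restrict G L = record { verts = verts G ; IsEdge = λ g → IsEdge G g × g ∈ᴸ L }

  -- vs and es list the vertices and edges from the endpoint p back to s; vertexAt and edgeAt
  -- index them in the same order, so vertexAt P zero is p.
  data BergePath (G : Hypergraph n) (s : Fin n) : Fin n → List (Fin n) → List (Subset n) → Set where
    []   : BergePath G s s (s ∷ []) []
    snoc : BergePath G s p vs es → Hop G p g q → q ∉ᴸ vs → g ∉ᴸ es →
           BergePath G s q (q ∷ vs) (g ∷ es)

  module _ {s : Fin n} where

    vertexAt : BergePath G s p vs es → Fin (suc (length es)) → Fin n
    vertexAt []                        zero    = s
    vertexAt (snoc {q = q} _ _ _ _)    zero    = q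
    vertexAt (snoc P _ _ _)            (suc i) = vertexAt P i

    edgeAt : BergePath G s p vs es → Fin (length es) → Subset n
    edgeAt (snoc {g = g} _ _ _ _) zero    = g
    edgeAt (snoc P _ _ _)         (suc i) = edgeAt P i

    vertexAt-zero : (P : BergePath G s p vs es) → vertexAt P zero ≡ p
    vertexAt-zero []             = refl
    vertexAt-zero (snoc _ _ _ _) = refl

    vertexAt-last : (P : BergePath G s p vs es) → vertexAt P (fromℕ (length es)) ≡ s
    vertexAt-last []             = refl
    vertexAt-last (snoc P _ _ _) = vertexAt-last P

    vertexAt∈ : (P : BergePath G s p vs es) → ∀ i → vertexAt P i ∈ᴸ vs
    vertexAt∈ []             zero    = here refl
    vertexAt∈ (snoc _ _ _ _) zero    = here refl
    vertexAt∈ (snoc P _ _ _) (suc i) = there (vertexAt∈ P i)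

    edgeAt∈ : (P : BergePath G s p vs es) → ∀ i → edgeAt P i ∈ᴸ es
    edgeAt∈ (snoc _ _ _ _) zero    = here refl
    edgeAt∈ (snoc P _ _ _) (suc i) = there (edgeAt∈ P i)

    vertexAt-injective : (P : BergePath G s p vs es) → Injective _≡_ _≡_ (vertexAt P)
    vertexAt-injective []                {zero} {zero} _ = refl
    vertexAt-injective (snoc P _ q∉vs _) = fresh-head⇒injective
      (λ i q≡ → q∉vs (subst (_∈ᴸ _) (sym q≡) (vertexAt∈ P i))) (vertexAt-injective P)

    edgeAt-injective : (P : BergePath G s p vs es) → Injective _≡_ _≡_ (edgeAt P)
    edgeAt-injective (snoc P _ _ g∉es) = fresh-head⇒injective
      (λ i g≡ → g∉es (subst (_∈ᴸ _) (sym g≡) (edgeAt∈ P i))) (edgeAt-injective P)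

    edgeAt-isEdge : (P : BergePath G s p vs es) → ∀ i → IsEdge G (edgeAt P i)
    edgeAt-isEdge (snoc _ h _ _) zero    = Hop.isEdge h
    edgeAt-isEdge (snoc P _ _ _) (suc i) = edgeAt-isEdge P i

    later∈edgeAt : (P : BergePath G s p vs es) → ∀ i → vertexAt P (inject₁ i) ∈ edgeAt P i
    later∈edgeAt (snoc _ h _ _) zero    = Hop.dst h
    later∈edgeAt (snoc P _ _ _) (suc i) = later∈edgeAt P i

    earlier∈edgeAt : (P : BergePath G s p vs es) → ∀ i → vertexAt P (suc i) ∈ edgeAt P i
    earlier∈edgeAt (snoc P h _ _) zero    = subst (_∈ _) (sym (vertexAt-zero P)) (Hop.src h)
    earlier∈edgeAt (snoc P _ _ _) (suc i) = earlier∈edgeAt P i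

    ∈edges⇒isEdge : BergePath G s p vs es → g ∈ᴸ es → IsEdge G g
    ∈edges⇒isEdge (snoc _ h _ _) (here refl)  = Hop.isEdge h
    ∈edges⇒isEdge (snoc P _ _ _) (there g∈es) = ∈edges⇒isEdge P g∈es

    1≤length : BergePath G s p vs es → s ≢ p → 1 ≤ length es
    1≤length []             s≢s = ⊥-elim (s≢s refl)
    1≤length (snoc _ _ _ _) _   = s≤s z≤n

    truncateAt : BergePath G s p vs es → q ∈ᴸ vs → ∃₂ (BergePath G s q)
    truncateAt []               (here refl)  = -, -, []
    truncateAt P@(snoc _ _ _ _) (here refl)  = -, -, P
    truncateAt (snoc P _ _ _)   (there q∈vs) = truncateAt P q∈vs

    truncateBefore : BergePath G s p vs es → g ∈ᴸ es →
                     ∃[ a ] a ∈ g × ∃₂ λ vs′ es′ → BergePath G s a vs′ es′ × (∀ {v} → v ∈ᴸ vs′ → v ∈ᴸ vs) × g ∉ᴸ es′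
    truncateBefore (snoc P h _ g∉es) (here refl)  = -, Hop.src h , -, -, P , there , g∉es
    truncateBefore (snoc P _ _ _)    (there g∈es) with truncateBefore P g∈es
    ... | a , a∈g , _ , _ , P′ , vs′⊆vs , g∉es′ = a , a∈g , -, -, P′ , there ∘ vs′⊆vs , g∉es′

    -- Loop erasure: a hop back onto the path cuts the path at the revisited vertex or edge.
    extend : BergePath G s p vs es → Hop G p g q → ∃₂ (BergePath G s q)
    extend {vs = vs} {es} {g = g} {q} P h with q ∈ᵛ? vs
    ... | yes q∈vs = truncateAt P q∈vs
    ... | no q∉vs with g ∈ᵉ? es
    ...   | no g∉es = -, -, snoc P h q∉vs g∉es
    ...   | yes g∈es with truncateBefore P g∈es
    ...     | a , a∈g , _ , _ , P′ , vs′⊆vs , g∉es′ =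
              -, -, snoc P′ (hop (Hop.isEdge h) a∈g (Hop.dst h)) (q∉vs ∘ vs′⊆vs) g∉es′

    erase : Walk G s p → ∃₂ (BergePath G s p)
    erase []      = -, -, []
    erase (W ▷ h) = extend (proj₂ (proj₂ (erase W))) h

    toPath : (∀ {g} → IsEdge G g → g ⊆ verts G) → s ∈ verts G → BergePath G s p vs es → Path G
    toPath {G = G} edges⊆verts s∈V P = record
      { len     = _
      ; pv      = vertexAt P
      ; pe      = edgeAt P
      ; pv-inj  = vertexAt-injective P
      ; pv-in   = vertexAt∈verts P
      ; pe-edge = edgeAt-isEdge P
      ; pe-in₁  = later∈edgeAt P
      ; pe-in₂  = earlier∈edgeAt P
      }
      where
      vertexAt∈verts : (P : BergePath G s p vs es) → ∀ i → vertexAt P i ∈ verts G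
      vertexAt∈verts []             zero    = s∈V
      vertexAt∈verts (snoc _ h _ _) zero    = edges⊆verts (Hop.isEdge h) (Hop.dst h)
      vertexAt∈verts (snoc P _ _ _) (suc i) = vertexAt∈verts P i

    closeBergePath : (∀ {g} → IsEdge H g → IsEdge G g) → (P : BergePath H s p vs es) →
                     Hop G p g s → g ∉ᴸ es → BergeCycle G (suc (length es))
    closeBergePath {H = H} {G = G} {p = p} {es = es} {g = g} H⊆G P (hop g-edge p∈g s∈g) g∉es =
      vertexAt P , cycleEdge , vertexAt-injective P , cycleEdge-injective , incident
      where
      t = length es

      cycleEdge : Fin (suc t) → Subset _
      cycleEdge = insertAt (edgeAt P) (fromℕ t) g

      cycleEdge-inject₁ : ∀ i → cycleEdge (inject₁ i) ≡ edgeAt P i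
      cycleEdge-inject₁ i =
        trans (cong cycleEdge (sym (punchIn-fromℕ i))) (insertAt-punchIn (edgeAt P) (fromℕ t) g i)

      cycleEdge-last : cycleEdge (fromℕ t) ≡ g
      cycleEdge-last = insertAt-lookup (edgeAt P) (fromℕ t) g

      g≢edgeAt : ∀ i → g ≢ edgeAt P i
      g≢edgeAt i g≡ = g∉es (subst (_∈ᴸ es) (sym g≡) (edgeAt∈ P i))

      cycleEdge-injective : Injective _≡_ _≡_ cycleEdge
      cycleEdge-injective {i} {j} eq with view i | view j
      ... | ‵fromℕ      | ‵fromℕ      = refl
      ... | ‵inject₁ i′ | ‵inject₁ j′ = cong inject₁ (edgeAt-injective P
            (trans (sym (cycleEdge-inject₁ i′)) (trans eq (cycleEdge-inject₁ j′))))
      ... | ‵fromℕ      | ‵inject₁ j′ =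
            ⊥-elim (g≢edgeAt j′ (trans (sym cycleEdge-last) (trans eq (cycleEdge-inject₁ j′))))
      ... | ‵inject₁ i′ | ‵fromℕ      =
            ⊥-elim (g≢edgeAt i′ (trans (sym cycleEdge-last) (trans (sym eq) (cycleEdge-inject₁ i′))))

      incident : ∀ i → IsEdge G (cycleEdge i) × vertexAt P i ∈ cycleEdge i × vertexAt P (next i) ∈ cycleEdge i
      incident i with view i
      ... | ‵fromℕ rewrite cycleEdge-last | next-fromℕ t | vertexAt-last P | vertexAt-zero P =
            g-edge , s∈g , p∈g
      ... | ‵inject₁ j rewrite cycleEdge-inject₁ j | next-inject₁ j =
            H⊆G (edgeAt-isEdge P j) , later∈edgeAt P j , earlier∈edgeAt P j

  walk+edge⇒BergeCycle : Walk (restrict G L) x y → x ≢ y → Hop G y g x → g ∉ᴸ L →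
                         ∃[ m ] 2 ≤ m × m ≤ suc (length L) × BergeCycle G m
  walk+edge⇒BergeCycle W x≢y closing g∉L with erase W
  ... | _ , es , P =
    suc (length es) ,
    s≤s (1≤length P x≢y) ,
    s≤s (≤-length (edgeAt P) (edgeAt-injective P) (proj₂ ∘ edgeAt-isEdge P)) ,
    closeBergePath proj₁ P closing (g∉L ∘ proj₂ ∘ ∈edges⇒isEdge P)

  BergeCycle-mono : (∀ {g} → IsEdge G g → IsEdge H g) → BergeCycle G m → BergeCycle H m
  BergeCycle-mono {m = suc m} G⊆H (v , e , v-injective , e-injective , incident) =
    v , e , v-injective , e-injective , λ i → let (e-edge , v∈e , v′∈e) = incident i in G⊆H e-edge , v∈e , v′∈e

  BergeCycle-length≤ : (∀ {g} → IsEdge G g → g ∈ᴸ L) → BergeCycle G m → m ≤ length L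
  BergeCycle-length≤ {m = suc m} edges∈L (_ , e , _ , e-injective , incident) =
    ≤-length e e-injective (edges∈L ∘ proj₁ ∘ incident)

  ¬BergeCycle₂⇒linear : ¬ BergeCycle G 2 → Linear G
  ¬BergeCycle₂⇒linear {G = G} no-2-cycle e f e-edge f-edge e≢f =
    decidable-stable (∣ e ∩ f ∣ ≤? 1) λ ∣e∩f∣≰1 →
      let x , y , x≢y , x∈e∩f , y∈e∩f = ∣p∣≥2⇒distinct (≰⇒> ∣e∩f∣≰1)
          x∈e , x∈f = x∈p∩q⁻ e f x∈e∩f
          y∈e , y∈f = x∈p∩q⁻ e f y∈e∩f
          m , 2≤m , m≤2 , cycle = walk+edge⇒BergeCycle {G = G} {L = e ∷ []}
            ([] ▷ hop (e-edge , here refl) x∈e y∈e) x≢y (hop f-edge y∈f x∈f) f∉[e]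
      in no-2-cycle (subst (BergeCycle G) (≤-antisym m≤2 2≤m) cycle)
    where
    f∉[e] : f ∉ᴸ e ∷ []
    f∉[e] (here f≡e) = e≢f (sym f≡e)

  walks⇒connected : (∀ {g} → IsEdge G g → g ⊆ verts G) →
                    (∀ {x y} → x ∈ verts G → y ∈ verts G → Walk G x y) → Connected G
  walks⇒connected edges⊆verts walk x y x∈V y∈V with erase (walk x∈V y∈V)
  ... | _ , _ , P = toPath edges⊆verts x∈V P , (fromℕ _ , vertexAt-last P) , (zero , vertexAt-zero P)

-- The vertex v_x of C^(1+c)_k is encoded as pos x = x mod ck, so that v_(ck) = v_0.
module LinearCycle (c₀ k₀ : ℕ) where

  c k M : ℕ
  c = suc c₀
  k = suc (suc k₀)
  M = c * k

  incident? : Fin k → Fin M → Bool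
  incident? a j = ((c * toℕ a ≤ᵇ toℕ j) ∧ (toℕ j ≤ᵇ c * suc (toℕ a))) ∨ ((toℕ j ≡ᵇ 0) ∧ (suc (toℕ a) ≡ᵇ k))

  -- linCycleEdge (suc c) k, unfolded
  edge : Fin k → Subset M
  edge a = Vec.tabulate (incident? a)

  ∈edge⁺ : ∀ a (j : Fin M) → c * toℕ a ≤ toℕ j → toℕ j ≤ c * suc (toℕ a) → j ∈ edge a
  ∈edge⁺ a j lo hi =
    T⇒∈tabulate {h = incident? a} (Equivalence.from T-∨ (inj₁ (Equivalence.from T-∧ (≤⇒≤ᵇ lo , ≤⇒≤ᵇ hi))))

  ∈edge-wrap : ∀ a (j : Fin M) → toℕ j ≡ 0 → suc (toℕ a) ≡ k → j ∈ edge a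
  ∈edge-wrap a j j≡0 last = T⇒∈tabulate {h = incident? a} (Equivalence.from T-∨ (inj₂
    (Equivalence.from T-∧ (≡⇒≡ᵇ (toℕ j) 0 j≡0 , ≡⇒≡ᵇ (suc (toℕ a)) k last))))

  ∈edge⁻ : ∀ {a} {j : Fin M} → j ∈ edge a →
           (c * toℕ a ≤ toℕ j × toℕ j ≤ c * suc (toℕ a)) ⊎ (toℕ j ≡ 0 × suc (toℕ a) ≡ k)
  ∈edge⁻ {a} {j} j∈ with Equivalence.to T-∨ (∈tabulate⇒T {h = incident? a} j∈)
  ... | inj₁ in-range = let (lo , hi) = Equivalence.to T-∧ in-range in
                        inj₁ (≤ᵇ⇒≤ _ _ lo , ≤ᵇ⇒≤ _ _ hi)
  ... | inj₂ wrap     = let (j≡0 , last) = Equivalence.to T-∧ wrap in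
                        inj₂ (≡ᵇ⇒≡ (toℕ j) 0 j≡0 , ≡ᵇ⇒≡ (suc (toℕ a)) k last)

  pos : ℕ → Fin M
  pos x = fromℕ< (m%n<n x M)

  toℕ-pos : ∀ {x} → x < M → toℕ (pos x) ≡ x
  toℕ-pos x<M = trans (toℕ-fromℕ< _) (m<n⇒m%n≡m x<M)

  toℕ-pos-M : toℕ (pos M) ≡ 0
  toℕ-pos-M = trans (toℕ-fromℕ< _) (n%n≡0 M)

  pos-toℕ : ∀ (j : Fin M) → pos (toℕ j) ≡ j
  pos-toℕ j = toℕ-injective (toℕ-pos (toℕ<n j))

  pos∈edge : ∀ a {x} → c * toℕ a ≤ x → x ≤ c * suc (toℕ a) → pos x ∈ edge a
  pos∈edge a {x} lo hi with m≤n⇒m<n∨m≡n (≤-trans hi (*-monoʳ-≤ c (toℕ<n a)))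
  ... | inj₁ x<M  = ∈edge⁺ a (pos x) (≤-trans lo (≤-reflexive (sym (toℕ-pos x<M))))
                                     (≤-trans (≤-reflexive (toℕ-pos x<M)) hi)
  ... | inj₂ refl = ∈edge-wrap a (pos M) toℕ-pos-M
                      (≤-antisym (toℕ<n a) (*-cancelˡ-≤ c hi))

  edge-positions : ∀ {a} {j : Fin M} → j ∈ edge a → ∃[ d ] d ≤ c × j ≡ pos (c * toℕ a + d)
  edge-positions {a} {j} j∈ with ∈edge⁻ j∈
  ... | inj₁ (lo , hi) = toℕ j ∸ c * toℕ a , d≤c , sym (trans (cong pos (m+[n∸m]≡n lo)) (pos-toℕ j))
    where
    d≤c : toℕ j ∸ c * toℕ a ≤ c
    d≤c = ≤-trans (∸-monoˡ-≤ (c * toℕ a) hi)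
                  (≤-reflexive (trans (cong (_∸ c * toℕ a) (*-suc c (toℕ a))) (m+n∸n≡m c (c * toℕ a))))
  ... | inj₂ (j≡0 , last) = c , ≤-refl , toℕ-injective (trans j≡0 (sym wrap))
    where
    wrap : toℕ (pos (c * toℕ a + c)) ≡ 0
    wrap = trans (cong (toℕ ∘ pos) (trans (+-comm (c * toℕ a) c)
                   (trans (sym (*-suc c (toℕ a))) (cong (c *_) last))))
                 toℕ-pos-M

  edge-cover : ∀ (j : Fin M) → ∃[ a ] j ∈ edge a
  edge-cover j = a , ∈edge⁺ a j lo hi
    where
    i : ℕ
    i = toℕ j / c

    i<k : i < k
    i<k = m<n*o⇒m/o<n (subst (toℕ j <_) (*-comm c k) (toℕ<n j))

    a : Fin k
    a = fromℕ< i<k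

    lo : c * toℕ a ≤ toℕ j
    lo = subst (_≤ toℕ j) (trans (*-comm i c) (cong (c *_) (sym (toℕ-fromℕ< i<k)))) (m/n*n≤m (toℕ j) c)

    hi : toℕ j ≤ c * suc (toℕ a)
    hi = <⇒≤ (begin-strict
      toℕ j                 ≡⟨ m≡m%n+[m/n]*n (toℕ j) c ⟩
      toℕ j % c + i * c     <⟨ +-monoˡ-< (i * c) (m%n<n (toℕ j) c) ⟩
      c + i * c             ≡⟨ cong (c +_) (*-comm i c) ⟩
      c + c * i             ≡⟨ sym (*-suc c i) ⟩
      c * suc i             ≡⟨ cong (λ t → c * suc t) (sym (toℕ-fromℕ< i<k)) ⟩
      c * suc (toℕ a)       ∎)
      where open ≤-Reasoning

module ImageOfLinearCycle
  {c₀ k₀ n : ℕ} {E : Subset n → Set}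
  (uniform : Uniform (suc (suc c₀)) (full E))
  (short-cycle-free : ∀ m → 2 ≤ m → m ≤ suc (suc k₀) → ¬ BergeCycle (full E) m)
  (φ : Fin (suc c₀ * suc (suc k₀)) → Fin n)
  (hom : Homomorphism (suc (suc c₀)) (suc (suc k₀)) φ (full E))
  where

  open LinearCycle c₀ k₀

  S : Subset n
  S = image φ ⊤

  G : Hypergraph n
  G = induced (full E) S

  w : Fin k → Subset n
  w a = image φ (edge a)

  u : ℕ → Fin n
  u i = φ (pos (c * i))

  w-isEdge : ∀ a → IsEdge G (w a)
  w-isEdge a = hom a , λ y∈w →
    let j , _ , φj≡y = ∈-image⁻ φ (edge a) y∈w in subst (_∈ S) φj≡y (∈-image⁺ φ ∈⊤)

  u-k≡u-0 : u k ≡ u 0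
  u-k≡u-0 = cong φ (trans (toℕ-injective (trans toℕ-pos-M (sym (toℕ-pos (s≤s z≤n)))))
                          (cong pos (sym (*-zeroʳ c))))

  u∈w : ∀ a → u (toℕ a) ∈ w a × u (suc (toℕ a)) ∈ w a
  u∈w a = ∈-image⁺ φ (pos∈edge a ≤-refl (*-monoʳ-≤ c (n≤1+n _))) ,
          ∈-image⁺ φ (pos∈edge a (*-monoʳ-≤ c (n≤1+n _)) ≤-refl)

  -- If u_i = u_(i+1), the edge w a = φ{v_ci, …, v_(ci+c)} has at most c = r - 1 vertices.
  u-distinct : ∀ a → u (toℕ a) ≢ u (suc (toℕ a))
  u-distinct a u≡ = 1+n≰n (subst (_≤ c) (uniform (w a) (hom a))
                             (≤-trans (∣p∣≤length others w⊆others) (≤-reflexive (length-tabulate other))))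
    where
    i : ℕ
    i = toℕ a

    other : Fin c → Fin n
    other t = φ (pos (c * i + suc (toℕ t)))

    others : List (Fin n)
    others = tabulate other

    far-end : φ (pos (c * i + suc (toℕ (fromℕ c₀)))) ≡ φ (pos (c * i + 0))
    far-end = begin
      φ (pos (c * i + suc (toℕ (fromℕ c₀))))  ≡⟨ cong (λ t → φ (pos (c * i + suc t))) (toℕ-fromℕ c₀) ⟩
      φ (pos (c * i + c))                      ≡⟨ cong (φ ∘ pos) (trans (+-comm (c * i) c) (sym (*-suc c i))) ⟩
      u (suc i)                                ≡⟨ sym u≡ ⟩
      u i                                      ≡⟨ cong (φ ∘ pos) (sym (+-identityʳ (c * i))) ⟩
      φ (pos (c * i + 0))                      ∎
      where open ≡-Reasoning

    w⊆others : ∀ {y} → y ∈ w a → y ∈ᴸ others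
    w⊆others y∈w with ∈-image⁻ φ (edge a) y∈w
    ... | j , j∈ , refl with edge-positions {a} j∈
    ...   | zero  , _   , j≡ = subst (_∈ᴸ others) (trans far-end (cong φ (sym j≡)))
                                 (∈-tabulate⁺ {f = other} (fromℕ c₀))
    ...   | suc d , d<c , j≡ = subst (_∈ᴸ others)
                                 (trans (cong (λ t → φ (pos (c * i + suc t))) (toℕ-fromℕ< d<c)) (cong φ (sym j≡)))
                                 (∈-tabulate⁺ {f = other} (fromℕ< d<c))

  hopAt : ∀ {H : Hypergraph n} {m} (m<k : m < k) → IsEdge H (w (fromℕ< m<k)) →
          Hop H (u m) (w (fromℕ< m<k)) (u (suc m))
  hopAt {H} m<k isEdge = subst (λ t → Hop H (u t) (w (fromℕ< m<k)) (u (suc t))) (toℕ-fromℕ< m<k)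
                               (hop isEdge (proj₁ (u∈w (fromℕ< m<k))) (proj₂ (u∈w (fromℕ< m<k))))

  segment : ∀ {H : Hypergraph n} {i j} →
            (∀ {m} (m<k : m < k) → i ≤ m → m < j → IsEdge H (w (fromℕ< m<k))) →
            i ≤′ j → j ≤ k → Walk H (u i) (u j)
  segment allowed ≤′-refl           _   = []
  segment allowed (≤′-step i≤′m) m<k =
    segment (λ l<k i≤l l<m → allowed l<k i≤l (m≤n⇒m≤1+n l<m)) i≤′m (<⇒≤ m<k) ▷
    hopAt m<k (allowed m<k (≤′⇒≤ i≤′m) ≤-refl)

  fromℕ<≢ : ∀ {m a} (m<k : m < k) → m ≢ toℕ a → fromℕ< m<k ≢ a
  fromℕ<≢ m<k m≢a b≡a = m≢a (trans (sym (toℕ-fromℕ< m<k)) (cong toℕ b≡a))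

  around : ∀ {H : Hypergraph n} a → (∀ b → b ≢ a → IsEdge H (w b)) →
           Walk H (u (suc (toℕ a))) (u (toℕ a))
  around {H} a allowed =
    subst (Walk H _) u-k≡u-0 (segment after (≤⇒≤′ (toℕ<n a)) ≤-refl) ++ᵂ
    segment before (≤⇒≤′ z≤n) (<⇒≤ (toℕ<n a))
    where
    after : ∀ {m} (m<k : m < k) → suc (toℕ a) ≤ m → m < k → IsEdge H (w (fromℕ< m<k))
    after m<k a<m _ = allowed (fromℕ< m<k) (fromℕ<≢ m<k (>⇒≢ a<m))

    before : ∀ {m} (m<k : m < k) → 0 ≤ m → m < toℕ a → IsEdge H (w (fromℕ< m<k))
    before m<k _ m<a = allowed (fromℕ< m<k) (fromℕ<≢ m<k (<⇒≢ m<a))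

  viaHub : ∀ {H : Hypergraph n} {x y} → (∀ b → IsEdge H (w b)) → x ∈ S → y ∈ S → Walk H x y
  viaHub {H = H} allowed x∈S y∈S = toHub x∈S ++ᵂ fromHub y∈S
    where
    on-edge : ∀ {v} → v ∈ S → ∃[ a ] v ∈ w a
    on-edge v∈S with ∈-image⁻ φ ⊤ v∈S
    ... | j , _ , refl = let (a , j∈) = edge-cover j in a , ∈-image⁺ φ j∈

    toHub : ∀ {v} → v ∈ S → Walk H v (u 0)
    toHub {v} v∈S with on-edge v∈S
    ... | a , v∈w = subst (Walk H v) u-k≡u-0
      (([] ▷ hop (allowed a) v∈w (proj₂ (u∈w a))) ++ᵂ
       segment (λ m<k _ _ → allowed (fromℕ< m<k)) (≤⇒≤′ (toℕ<n a)) ≤-refl)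

    fromHub : ∀ {v} → v ∈ S → Walk H (u 0) v
    fromHub v∈S with on-edge v∈S
    ... | a , v∈w = segment (λ m<k _ _ → allowed (fromℕ< m<k)) (≤⇒≤′ z≤n) (<⇒≤ (toℕ<n a)) ▷
                    hop (allowed a) (proj₁ (u∈w a)) v∈w

  cycle-free : ∀ m → 2 ≤ m → m ≤ k → ¬ BergeCycle G m
  cycle-free m 2≤m m≤k = short-cycle-free m 2≤m m≤k ∘ BergeCycle-mono proj₁

  othersThan : Fin k → List (Subset n)
  othersThan a = tabulate (w ∘ punchIn a)

  w∈othersThan : ∀ {a b} → b ≢ a → w b ∈ᴸ othersThan a
  w∈othersThan {a} b≢a = subst (λ b′ → w b′ ∈ᴸ othersThan a) (punchIn-punchOut (b≢a ∘ sym))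
                                (∈-tabulate⁺ {f = w ∘ punchIn a} (punchOut (b≢a ∘ sym)))

  -- If w a occurred only once, going around the cycle from u_(a+1) back to u_a would avoid it.
  repeated : ∀ a → ∃[ b ] b ≢ a × w b ≡ w a
  repeated a with w a ∈ᵉ? othersThan a
  ... | yes w[a]∈ = let t , w≡ = ∈-tabulate⁻ {f = w ∘ punchIn a} w[a]∈ in
                    punchIn a t , punchInᵢ≢i a t , sym w≡
  ... | no w[a]∉ =
    let m , 2≤m , m≤k , cycle = walk+edge⇒BergeCycle {G = G}
          (around {H = restrict G (othersThan a)} a (λ b b≢a → w-isEdge b , w∈othersThan {a} {b} b≢a)) (u-distinct a ∘ sym)
          (hop (w-isEdge a) (proj₁ (u∈w a)) (proj₂ (u∈w a))) w[a]∉
    in ⊥-elim (cycle-free m 2≤m (≤-trans m≤k (s≤s (≤-reflexive (length-tabulate (w ∘ punchIn a))))) cycle)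

  module _ (L : List (Subset n)) (w∈L : ∀ a → w a ∈ᴸ L) (L-short : length L + length L ≤ k) where

    edges∈L : ∀ {g} → IsEdge G g → g ∈ᴸ L
    edges∈L {g} g-edge = decidable-stable (g ∈ᵉ? L) λ g∉L →
      let x , y , x≢y , x∈g , y∈g = ∣p∣≥2⇒distinct {p = g}
                                      (≤-trans (s≤s (s≤s z≤n)) (≤-reflexive (sym (uniform g (proj₁ g-edge)))))
          m , 2≤m , m≤1+L , cycle = walk+edge⇒BergeCycle
            (viaHub {H = restrict G L} (λ b → w-isEdge b , w∈L b) (proj₂ g-edge x∈g) (proj₂ g-edge y∈g))
            x≢y (hop g-edge y∈g x∈g) g∉L
      in cycle-free m 2≤m (≤-trans m≤1+L (m+m≤k⇒1+m≤k _ (s≤s (s≤s z≤n)) L-short)) cycle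

    linearTree : LinearTree G
    linearTree =
      ¬BergeCycle₂⇒linear {G = G} (cycle-free 2 ≤-refl (s≤s (s≤s z≤n))) ,
      walks⇒connected {G = G} proj₂ (viaHub w-isEdge) ,
      λ m 2≤m cycle → cycle-free m 2≤m
        (≤-trans (BergeCycle-length≤ {G = G} edges∈L cycle) (≤-trans (m≤m+n _ _) L-short)) cycle

  -- Opaque: unfolding it would make the type checker evaluate the deduplication.
  opaque
    halfCover : ∃[ L ] (∀ a → w a ∈ᴸ L) × length L + length L ≤ k
    halfCover = repeated⇒halfCover _≟ˢ_ w repeated

  smallLinearTree : LinearTree G × ∃[ L ] length L + length L ≤ k × (∀ g → IsEdge G g → g ∈ᴸ L)
  smallLinearTree = let L , w∈L , L-short = halfCover in
                    linearTree L w∈L L-short , L , L-short , λ _ → edges∈L L w∈L L-short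

proposition2p1 : (r ℓ n : ℕ) → 3 ≤ r → 2 ≤ ℓ →
    (E : Subset n → Set) → Uniform r (full E) → Girth (full E) (2 * ℓ + 2) →
    (φ : Fin ((r ∸ 1) * (2 * ℓ + 1)) → Fin n) →
    Homomorphism r (2 * ℓ + 1) φ (full E) →
    LinearTree (induced (full E) (image φ ⊤)) × AtMostEdges ℓ (induced (full E) (image φ ⊤))
proposition2p1 (suc (suc (suc _))) ℓ@(suc (suc _)) n (s≤s (s≤s (s≤s _))) (s≤s (s≤s _)) E uniform (_ , girth) φ hom =
  let (tree , L , L-short , edges∈L) = smallLinearTree in
  tree , L , m+m≤1+n+n⇒m≤n _ ℓ (subst (length L + length L ≤_) 2ℓ+1≡1+ℓ+ℓ L-short) , edges∈L
  where
  short-cycle-free : ∀ m → 2 ≤ m → m ≤ 2 * ℓ + 1 → ¬ BergeCycle (full E) m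
  short-cycle-free m 2≤m m≤k = girth m 2≤m (≤-trans (s≤s m≤k) (≤-reflexive (sym (+-suc (2 * ℓ) 1))))

  open ImageOfLinearCycle {k₀ = 2 * ℓ + 1 ∸ 2} uniform short-cycle-free φ hom

  2ℓ+1≡1+ℓ+ℓ : 2 * ℓ + 1 ≡ suc (ℓ + ℓ)
  2ℓ+1≡1+ℓ+ℓ = trans (+-comm (2 * ℓ) 1) (cong (λ t → suc (ℓ + t)) (+-identityʳ ℓ))
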